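{- Let $T$ be a tree and $u,v,r$ vertices of $T$, and let $c = LCA_T(u,v,r)$. Let $E'$ be a subset of the edges of $T$; give the edges in $E'$ weight $0$ and all other edges weight $1$. For $a,b\in T$ let $w(a,b)$ be the total weight of the path from $a$ to $b$, and let $W_{u,v,r}(x) = w(u,x)+w(v,x)+w(r,x)$. Let $c'$ be a vertex minimizing $W_{u,v,r}$ over all vertices of $T$. Then $w(c,c')=0$.
   Context: For an unrooted tree $T$ and vertices $a,b,r$, $a$ is an ancestor of $b$ with respect to root $r$ if $a$ lies on the unique path from $b$ to $r$ (a vertex is its own ancestor). $LCA_T(u,v,r)$ is the vertex $c$ that is an ancestor of both $u$ and $v$ with respect to $r$ such that every common ancestor of $u$ and $v$ is an ancestor of $c$; equivalently, $c$ is the unique vertex minimizing $d(u,c)+d(v,c)+d(r,c)$ where $d$ is the unweighted path distance. -}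

module Defs where

open import Data.Nat using (ℕ; zero; suc; _+_)
open import Data.Fin using (Fin)
open import Data.Bool using (Bool; true; false; T; if_then_else_; _∨_)
open import Data.List using (List; []; _∷_)
open import Data.List.Membership.Propositional using (_∈_)
open import Data.List.Relation.Unary.Unique.Propositional using (Unique)
open import Data.Product using (Σ; _×_; proj₁)
open import Relation.Binary.PropositionalEquality using (_≡_)

record Graph (n : ℕ) : Set where
  field
    adj    : Fin n → Fin n → Bool
    sym    : ∀ x y → adj x y ≡ adj y x
    irrefl : ∀ x → adj x x ≡ false

module _ {n : ℕ} (G : Graph n) where
  open Graph G

  data Walk : Fin n → Fin n → Set where
    []   : ∀ {x} → Walk x x
    step : ∀ {x y z} → T (adj x y) → Walk y z → Walk x z

  verts : ∀ {x y} → Walk x y → List (Fin n)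
  verts {x} []         = x ∷ []
  verts {x} (step _ p) = x ∷ verts p

  Path : Fin n → Fin n → Set
  Path x y = Σ (Walk x y) (λ p → Unique (verts p))

  weight : (Fin n → Fin n → ℕ) → ∀ {x y} → Walk x y → ℕ
  weight ω []                   = 0
  weight ω (step {x} {y} _ p) = ω x y + weight ω p

  record IsTree : Set where
    field
      connected : ∀ x y → Path x y
      unique    : ∀ x y (p q : Path x y) → verts (proj₁ p) ≡ verts (proj₁ q)

record Tree (n : ℕ) : Set where
  field
    graph  : Graph n
    isTree : IsTree graph

module _ {n : ℕ} (𝒯 : Tree n) where
  open Tree 𝒯

  path : ∀ x y → Walk graph x y
  path x y = proj₁ (IsTree.connected isTree x y)

  Ancestor : Fin n → Fin n → Fin n → Set
  Ancestor a b r = a ∈ verts graph (path b r)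

  IsLCA : (u v r c : Fin n) → Set
  IsLCA u v r c = Ancestor c u r × Ancestor c v r
                × (∀ a → Ancestor a u r → Ancestor a v r → Ancestor a c r)

  edgeWeight : (Fin n → Fin n → Bool) → Fin n → Fin n → ℕ
  edgeWeight E' x y = if E' x y ∨ E' y x then 0 else 1

  w : (Fin n → Fin n → Bool) → Fin n → Fin n → ℕ
  w E' a b = weight graph (edgeWeight E') (path a b)

  W : (Fin n → Fin n → Bool) → (u v r x : Fin n) → ℕ
  W E' u v r x = w E' u x + w E' v x + w E' r x

-- Let P be the tree path from c to x and y its second vertex. For a root t ∈ {u, v, r}
-- with y off the path from c to t, the path from t to x passes through c, so
-- w(t,x) = w(t,c) + w(c,x); for the remaining roots the triangle inequality gives
-- w(t,c) ≤ w(t,x) + w(c,x). Because c is the LCA, y lies on the path from c to at most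
-- one of u, v, r, hence W(c) + w(c,x) ≤ W(x) for every x, and a minimiser c' of W
-- satisfies w(c,c') = 0.
module Submission where

open import Defs
open import Data.Nat using (ℕ; _≤_; _+_; z≤n)
open import Data.Nat.Properties
open import Data.Nat.Solver using (module +-*-Solver)
open import Data.Fin using (Fin) renaming (_≟_ to _≟ᶠ_)
open import Data.Bool using (Bool; T; if_then_else_)
open import Data.Bool.Properties using (∨-comm)
open import Data.List using (List; []; _∷_)
open import Data.List.Relation.Unary.Any using (here; there)
open import Data.List.Relation.Unary.All using ([]; _∷_; tabulate) renaming (lookup to lookupᴬ)
open import Data.List.Relation.Unary.All.Properties using (¬Any⇒All¬)
open import Data.List.Relation.Unary.AllPairs using ([]; _∷_)
open import Data.List.Relation.Unary.Unique.Propositional using (Unique)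
open import Data.List.Membership.Propositional using (_∈_; _∉_)
open import Data.Product using (Σ; _×_; _,_; proj₂)
open import Data.Sum using (_⊎_; inj₁; inj₂)
open import Data.Empty using (⊥-elim)
open import Relation.Nullary using (yes; no)
open import Relation.Binary.PropositionalEquality

+-rotate : ∀ a b c → a + b + c ≡ b + c + a
+-rotate a b c = trans (+-assoc a b c) (+-comm a (b + c))

+-bound-two-far-one-near : ∀ {a₁ a₂ a₃ b₁ b₂ b₃} p →
  a₁ + p ≤ b₁ → a₂ + p ≤ b₂ → a₃ ≤ b₃ + p → a₁ + a₂ + a₃ + p ≤ b₁ + b₂ + b₃
+-bound-two-far-one-near {a₁} {a₂} {a₃} {b₁} {b₂} {b₃} p h₁ h₂ h₃ =
  +-cancelʳ-≤ p _ _ (subst₂ _≤_ lhs rhs (+-mono-≤ (+-mono-≤ h₁ h₂) h₃))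
  where
  open +-*-Solver
  lhs : a₁ + p + (a₂ + p) + a₃ ≡ a₁ + a₂ + a₃ + p + p
  lhs = solve 4 (λ a₁ a₂ a₃ p → a₁ :+ p :+ (a₂ :+ p) :+ a₃ := a₁ :+ a₂ :+ a₃ :+ p :+ p)
          refl a₁ a₂ a₃ p
  rhs : b₁ + b₂ + (b₃ + p) ≡ b₁ + b₂ + b₃ + p
  rhs = sym (+-assoc (b₁ + b₂) b₃ p)

module WalkProperties {n : ℕ} (G : Graph n) where
  open Graph G using (adj) renaming (sym to adj-sym)
  open import Data.List.Membership.DecPropositional (_≟ᶠ_ {n}) using (_∈?_)

  private
    Wk : Fin n → Fin n → Set
    Wk = Walk G

    vs : ∀ {a b} → Wk a b → List (Fin n)
    vs = verts G

  infixr 5 _++ʷ_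
  _++ʷ_ : ∀ {a b c} → Wk a b → Wk b c → Wk a c
  []       ++ʷ q = q
  step e p ++ʷ q = step e (p ++ʷ q)

  ∈-first : ∀ {a b} (p : Wk a b) → a ∈ vs p
  ∈-first []         = here refl
  ∈-first (step _ _) = here refl

  ∈-last : ∀ {a b} (p : Wk a b) → b ∈ vs p
  ∈-last []         = here refl
  ∈-last (step _ p) = there (∈-last p)

  ∈-++⁺ˡ : ∀ {a b c z} (p : Wk a b) (q : Wk b c) → z ∈ vs p → z ∈ vs (p ++ʷ q)
  ∈-++⁺ˡ []         q (here refl) = ∈-first q
  ∈-++⁺ˡ (step _ p) q (here refl) = here refl
  ∈-++⁺ˡ (step _ p) q (there z∈p) = there (∈-++⁺ˡ p q z∈p)

  ∈-++⁺ʳ : ∀ {a b c z} (p : Wk a b) (q : Wk b c) → z ∈ vs q → z ∈ vs (p ++ʷ q)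
  ∈-++⁺ʳ []         q z∈q = z∈q
  ∈-++⁺ʳ (step _ p) q z∈q = there (∈-++⁺ʳ p q z∈q)

  ∈-++⁻ : ∀ {a b c z} (p : Wk a b) (q : Wk b c) → z ∈ vs (p ++ʷ q) → z ∈ vs p ⊎ z ∈ vs q
  ∈-++⁻ []         q z∈          = inj₂ z∈
  ∈-++⁻ (step _ p) q (here refl) = inj₁ (here refl)
  ∈-++⁻ (step _ p) q (there z∈) with ∈-++⁻ p q z∈
  ... | inj₁ z∈p = inj₁ (there z∈p)
  ... | inj₂ z∈q = inj₂ z∈q

  Unique-++⁻ˡ : ∀ {a b c} (p : Wk a b) (q : Wk b c) → Unique (vs (p ++ʷ q)) → Unique (vs p)
  Unique-++⁻ˡ []         q _         = [] ∷ []
  Unique-++⁻ˡ (step _ p) q (a∉ ∷ uq) =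
    tabulate (λ z∈p → lookupᴬ a∉ (∈-++⁺ˡ p q z∈p)) ∷ Unique-++⁻ˡ p q uq

  Unique-++⁻ʳ : ∀ {a b c} (p : Wk a b) (q : Wk b c) → Unique (vs (p ++ʷ q)) → Unique (vs q)
  Unique-++⁻ʳ []         q uq       = uq
  Unique-++⁻ʳ (step _ p) q (_ ∷ uq) = Unique-++⁻ʳ p q uq

  Unique-++⇒shared≡junction : ∀ {a b c z} (p : Wk a b) (q : Wk b c) → Unique (vs (p ++ʷ q)) →
                              z ∈ vs p → z ∈ vs q → z ≡ b
  Unique-++⇒shared≡junction []         q _        (here refl) _   = refl
  Unique-++⇒shared≡junction (step _ p) q (a∉ ∷ _) (here refl) z∈q = ⊥-elim (lookupᴬ a∉ (∈-++⁺ʳ p q z∈q) refl)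
  Unique-++⇒shared≡junction (step _ p) q (_ ∷ uq) (there z∈p) z∈q = Unique-++⇒shared≡junction p q uq z∈p z∈q

  Unique-++⁺ : ∀ {a b c} (p : Wk a b) (q : Wk b c) → Unique (vs p) → Unique (vs q) →
               (∀ {z} → z ∈ vs p → z ∈ vs q → z ≡ b) → Unique (vs (p ++ʷ q))
  Unique-++⁺ []             q _         uq shared = uq
  Unique-++⁺ (step {x} _ p) q (x∉ ∷ up) uq shared =
    tabulate x≢ ∷ Unique-++⁺ p q up uq (λ z∈p → shared (there z∈p))
    where
    x≢ : ∀ {z} → z ∈ vs (p ++ʷ q) → x ≢ z
    x≢ z∈ with ∈-++⁻ p q z∈
    ... | inj₁ z∈p = lookupᴬ x∉ z∈p
    ... | inj₂ z∈q = λ { refl → lookupᴬ x∉ (subst (_∈ vs p) (sym (shared (here refl) z∈q)) (∈-last p)) refl }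

  splitAt : ∀ {a b z} (p : Wk a b) → z ∈ vs p → Σ (Wk a z) λ p₁ → Σ (Wk z b) λ p₂ → p₁ ++ʷ p₂ ≡ p
  splitAt []         (here refl) = [] , [] , refl
  splitAt (step e p) (here refl) = [] , step e p , refl
  splitAt (step e p) (there z∈p) with splitAt p z∈p
  ... | p₁ , p₂ , refl = step e p₁ , p₂ , refl

  Unique-step⇒≢ : ∀ {x y z} (e : T (adj x y)) (q : Wk y z) → Unique (vs (step e q)) → x ≢ y
  Unique-step⇒≢ _ q (x∉ ∷ _) = lookupᴬ x∉ (∈-first q)

  flip-edge : ∀ {x y} → T (adj x y) → T (adj y x)
  flip-edge {x} {y} = subst T (adj-sym x y)

  reverse : ∀ {a b} → Wk a b → Wk b a
  reverse []         = []
  reverse (step e p) = reverse p ++ʷ step (flip-edge e) []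

  ∈-reverse⁻ : ∀ {a b z} (p : Wk a b) → z ∈ vs (reverse p) → z ∈ vs p
  ∈-reverse⁻ []         z∈ = z∈
  ∈-reverse⁻ (step e p) z∈ with ∈-++⁻ (reverse p) (step (flip-edge e) []) z∈
  ... | inj₁ z∈p                 = there (∈-reverse⁻ p z∈p)
  ... | inj₂ (here refl)         = there (∈-first p)
  ... | inj₂ (there (here refl)) = here refl

  ∈-reverse⁺ : ∀ {a b z} (p : Wk a b) → z ∈ vs p → z ∈ vs (reverse p)
  ∈-reverse⁺ []         z∈          = z∈
  ∈-reverse⁺ (step e p) (here refl) = ∈-++⁺ʳ (reverse p) (step (flip-edge e) []) (there (here refl))
  ∈-reverse⁺ (step e p) (there z∈p) = ∈-++⁺ˡ (reverse p) (step (flip-edge e) []) (∈-reverse⁺ p z∈p)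

  Unique-reverse : ∀ {a b} (p : Wk a b) → Unique (vs p) → Unique (vs (reverse p))
  Unique-reverse []                 up        = up
  Unique-reverse (step {x} {y} e p) (x∉ ∷ up) =
    Unique-++⁺ (reverse p) (step (flip-edge e) []) (Unique-reverse p up) ((y≢x ∷ []) ∷ [] ∷ []) shared
    where
    y≢x : y ≢ x
    y≢x y≡x = lookupᴬ x∉ (∈-first p) (sym y≡x)
    shared : ∀ {z} → z ∈ vs (reverse p) → z ∈ vs (step (flip-edge e) []) → z ≡ y
    shared _   (here refl)         = refl
    shared z∈p (there (here refl)) = ⊥-elim (lookupᴬ x∉ (∈-reverse⁻ p z∈p) refl)

  module _ (ω : Fin n → Fin n → ℕ) where

    weight-++ : ∀ {a b c} (p : Wk a b) (q : Wk b c) → weight G ω (p ++ʷ q) ≡ weight G ω p + weight G ω q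
    weight-++ []                 q = refl
    weight-++ (step {x} {y} _ p) q = trans (cong (ω x y +_) (weight-++ p q)) (sym (+-assoc (ω x y) _ _))

    weightᵛ : List (Fin n) → ℕ
    weightᵛ []           = 0
    weightᵛ (_ ∷ [])     = 0
    weightᵛ (x ∷ y ∷ xs) = ω x y + weightᵛ (y ∷ xs)

    weight≡weightᵛ : ∀ {a b} (p : Wk a b) → weight G ω p ≡ weightᵛ (vs p)
    weight≡weightᵛ []                          = refl
    weight≡weightᵛ (step _ [])                 = refl
    weight≡weightᵛ (step {x} {y} _ (step e p)) = cong (ω x y +_) (weight≡weightᵛ (step e p))

    weight-cong-verts : ∀ {a b} (p q : Wk a b) → vs p ≡ vs q → weight G ω p ≡ weight G ω q
    weight-cong-verts p q eq = trans (weight≡weightᵛ p) (trans (cong weightᵛ eq) (sym (weight≡weightᵛ q)))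

    weight-reverse : (∀ x y → ω x y ≡ ω y x) → ∀ {a b} (p : Wk a b) → weight G ω (reverse p) ≡ weight G ω p
    weight-reverse ω-sym []                 = refl
    weight-reverse ω-sym (step {x} {y} e p) = begin
      weight G ω (reverse p ++ʷ step (flip-edge e) [])  ≡⟨ weight-++ (reverse p) _ ⟩
      weight G ω (reverse p) + (ω y x + 0)              ≡⟨ cong₂ _+_ (weight-reverse ω-sym p) (+-identityʳ _) ⟩
      weight G ω p + ω y x                              ≡⟨ cong (weight G ω p +_) (ω-sym y x) ⟩
      weight G ω p + ω x y                              ≡⟨ +-comm (weight G ω p) _ ⟩
      ω x y + weight G ω p                              ∎
      where open ≡-Reasoning

    -- Cutting out a closed subwalk cannot increase the weight, since edge weights are natural numbers.
    shortcut : ∀ {a b} (p : Wk a b) → Σ (Wk a b) λ q → Unique (vs q) × weight G ω q ≤ weight G ω p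
    shortcut []                 = [] , [] ∷ [] , z≤n
    shortcut (step {x} {y} e p) with shortcut p
    ... | q , uq , q≤p with x ∈? vs q
    ...   | no x∉q = step e q , ¬Any⇒All¬ _ x∉q ∷ uq , +-monoʳ-≤ (ω x y) q≤p
    ...   | yes x∈q with splitAt q x∈q
    ...     | q₁ , q₂ , refl =
      q₂ , Unique-++⁻ʳ q₁ q₂ uq ,
      ≤-trans (m≤n+m _ (weight G ω q₁))
        (≤-trans (≤-reflexive (sym (weight-++ q₁ q₂))) (≤-trans q≤p (m≤n+m _ (ω x y))))

module TreeProperties {n : ℕ} (𝒯 : Tree n) where
  open Tree 𝒯
  open Graph graph using (adj)
  open WalkProperties graph
  open import Data.List.Membership.DecPropositional (_≟ᶠ_ {n}) using (_∈?_)

  private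
    Wk : Fin n → Fin n → Set
    Wk = Walk graph

    vs : ∀ {a b} → Wk a b → List (Fin n)
    vs = verts graph

  path-Unique : ∀ a b → Unique (vs (path 𝒯 a b))
  path-Unique a b = proj₂ (IsTree.connected isTree a b)

  verts-path : ∀ {a b} (p : Wk a b) → Unique (vs p) → vs p ≡ vs (path 𝒯 a b)
  verts-path {a} {b} p up = IsTree.unique isTree a b (p , up) (path 𝒯 a b , path-Unique a b)

  ∈-path⇒∈-walk : ∀ {a b z} (p : Wk a b) → Unique (vs p) → z ∈ vs (path 𝒯 a b) → z ∈ vs p
  ∈-path⇒∈-walk p up = subst (_ ∈_) (sym (verts-path p up))

  ∈-path-sym : ∀ {a b z} → z ∈ vs (path 𝒯 a b) → z ∈ vs (path 𝒯 b a)
  ∈-path-sym {a} {b} z∈ = subst (_ ∈_) (verts-path (reverse (path 𝒯 a b)) (Unique-reverse _ (path-Unique a b)))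
                                        (∈-reverse⁺ (path 𝒯 a b) z∈)

  ∈-path-prefix : ∀ {a b y z} (p : Wk a b) → Unique (vs p) → z ∈ vs p →
                  y ∈ vs (path 𝒯 z a) → y ∈ vs p
  ∈-path-prefix p up z∈p y∈za with splitAt p z∈p
  ... | p₁ , p₂ , refl = ∈-++⁺ˡ p₁ p₂ (∈-path⇒∈-walk p₁ (Unique-++⁻ˡ p₁ p₂ up) (∈-path-sym y∈za))

  paths-from-inner-vertex-meet : ∀ {a b y z} (p : Wk a b) → Unique (vs p) → z ∈ vs p →
                                 y ∈ vs (path 𝒯 z a) → y ∈ vs (path 𝒯 z b) → y ≡ z
  paths-from-inner-vertex-meet p up z∈p y∈za y∈zb with splitAt p z∈p
  ... | p₁ , p₂ , refl =
    Unique-++⇒shared≡junction p₁ p₂ up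
      (∈-path⇒∈-walk p₁ (Unique-++⁻ˡ p₁ p₂ up) (∈-path-sym y∈za))
      (∈-path⇒∈-walk p₂ (Unique-++⁻ʳ p₁ p₂ up) y∈zb)

  -- Two paths out of c that meet again at z both follow the path from c to z,
  -- so they share the vertex after c.
  shared-vertex⇒shared-successor : ∀ {c y x t z} (e : T (adj c y)) (q : Wk y x) → Unique (vs (step e q)) →
                                   (p : Wk c t) → Unique (vs p) → z ∈ vs p → z ∈ vs q → y ∈ vs p
  shared-vertex⇒shared-successor e q uq p up z∈p z∈q with splitAt p z∈p | splitAt q z∈q
  ... | p₁ , p₂ , refl | q₁ , q₂ , refl =
    ∈-++⁺ˡ p₁ p₂ (subst (_ ∈_) (trans (verts-path (step e q₁) uq₁) (sym (verts-path p₁ up₁))) (there (∈-first q₁)))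
    where
    uq₁ = Unique-++⁻ˡ (step e q₁) q₂ uq
    up₁ = Unique-++⁻ˡ p₁ p₂ up

  path-++-Unique : ∀ {c y x} t (e : T (adj c y)) (q : Wk y x) → Unique (vs (step e q)) →
                   y ∉ vs (path 𝒯 c t) → Unique (vs (path 𝒯 t c ++ʷ step e q))
  path-++-Unique {c} t e q uq y∉ct = Unique-++⁺ (path 𝒯 t c) (step e q) (path-Unique t c) uq shared
    where
    shared : ∀ {z} → z ∈ vs (path 𝒯 t c) → z ∈ vs (step e q) → z ≡ c
    shared _    (here refl) = refl
    shared z∈tc (there z∈q) = ⊥-elim (y∉ct (shared-vertex⇒shared-successor e q uq
                                 (path 𝒯 c t) (path-Unique c t) (∈-path-sym z∈tc) z∈q))

  module _ (ω : Fin n → Fin n → ℕ) (ω-sym : ∀ x y → ω x y ≡ ω y x) where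

    dist : Fin n → Fin n → ℕ
    dist a b = weight graph ω (path 𝒯 a b)

    weight-Unique≡dist : ∀ {a b} (p : Wk a b) → Unique (vs p) → weight graph ω p ≡ dist a b
    weight-Unique≡dist p up = weight-cong-verts ω p _ (verts-path p up)

    dist-sym : ∀ a b → dist a b ≡ dist b a
    dist-sym a b = trans (sym (weight-reverse ω ω-sym (path 𝒯 a b)))
                         (weight-Unique≡dist (reverse (path 𝒯 a b)) (Unique-reverse _ (path-Unique a b)))

    dist-triangle : ∀ a b c → dist a c ≤ dist a b + dist b c
    dist-triangle a b c with shortcut ω (path 𝒯 a b ++ʷ path 𝒯 b c)
    ... | q , uq , q≤ = subst (_≤ dist a b + dist b c) (weight-Unique≡dist q uq)
                              (≤-trans q≤ (≤-reflexive (weight-++ ω (path 𝒯 a b) (path 𝒯 b c))))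

    dist-through : ∀ {c y x} t (e : T (adj c y)) (q : Wk y x) → Unique (vs (step e q)) →
                   y ∉ vs (path 𝒯 c t) → dist t c + weight graph ω (step e q) ≤ dist t x
    dist-through {c} t e q uq y∉ct = ≤-reflexive (sym
      (trans (sym (weight-Unique≡dist _ (path-++-Unique t e q uq y∉ct))) (weight-++ ω (path 𝒯 t c) (step e q))))

    dist-≤-via-path : ∀ t {c x} (P : Wk c x) → Unique (vs P) → dist t c ≤ dist t x + weight graph ω P
    dist-≤-via-path t {c} {x} P uP =
      subst (λ k → dist t c ≤ dist t x + k) (trans (dist-sym x c) (sym (weight-Unique≡dist P uP))) (dist-triangle t x c)

    Wsum : (u v r x : Fin n) → ℕ
    Wsum u v r x = dist u x + dist v x + dist r x

    Wsum-rotate : ∀ u v r x → Wsum u v r x ≡ Wsum v r u x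
    Wsum-rotate u v r x = +-rotate (dist u x) (dist v x) (dist r x)

    Wsum-bound : ∀ {c x} (P : Wk c x) t₁ t₂ t₃ →
                 dist t₁ c + weight graph ω P ≤ dist t₁ x → dist t₂ c + weight graph ω P ≤ dist t₂ x →
                 dist t₃ c ≤ dist t₃ x + weight graph ω P → Wsum t₁ t₂ t₃ c + weight graph ω P ≤ Wsum t₁ t₂ t₃ x
    Wsum-bound P _ _ _ = +-bound-two-far-one-near (weight graph ω P)

    LCA-bound : ∀ {u v r c x} → IsLCA 𝒯 u v r c → (P : Wk c x) → Unique (vs P) →
                Wsum u v r c + weight graph ω P ≤ Wsum u v r x
    LCA-bound _ [] _ = ≤-reflexive (+-identityʳ _)
    LCA-bound {u} {v} {r} {c} {x} (c∈ur , c∈vr , lca) P@(step {y = y} e q) uP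
      with y ∈? vs (path 𝒯 c u) | y ∈? vs (path 𝒯 c v) | y ∈? vs (path 𝒯 c r)
    ... | yes y∈cu | _ | yes y∈cr =
      ⊥-elim (Unique-step⇒≢ e q uP (sym (paths-from-inner-vertex-meet (path 𝒯 u r) (path-Unique u r) c∈ur y∈cu y∈cr)))
    ... | _ | yes y∈cv | yes y∈cr =
      ⊥-elim (Unique-step⇒≢ e q uP (sym (paths-from-inner-vertex-meet (path 𝒯 v r) (path-Unique v r) c∈vr y∈cv y∈cr)))
    ... | yes y∈cu | yes y∈cv | no y∉cr =
      ⊥-elim (y∉cr (lca y (∈-path-prefix (path 𝒯 u r) (path-Unique u r) c∈ur y∈cu)
                          (∈-path-prefix (path 𝒯 v r) (path-Unique v r) c∈vr y∈cv)))
    ... | yes _ | no y∉cv | no y∉cr =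
      subst₂ (λ a b → a + weight graph ω P ≤ b) (sym (Wsum-rotate u v r c)) (sym (Wsum-rotate u v r x))
        (Wsum-bound P v r u (dist-through v e q uP y∉cv) (dist-through r e q uP y∉cr) (dist-≤-via-path u P uP))
    ... | no y∉cu | yes _ | no y∉cr =
      subst₂ (λ a b → a + weight graph ω P ≤ b) (Wsum-rotate r u v c) (Wsum-rotate r u v x)
        (Wsum-bound P r u v (dist-through r e q uP y∉cr) (dist-through u e q uP y∉cu) (dist-≤-via-path v P uP))
    ... | no y∉cu | no y∉cv | _ =
      Wsum-bound P u v r (dist-through u e q uP y∉cu) (dist-through v e q uP y∉cv) (dist-≤-via-path r P uP)

lemma4p6 : ∀ {n} (𝒯 : Tree n) (u v r c : Fin n) → IsLCA 𝒯 u v r c →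
           (E' : Fin n → Fin n → Bool) (c' : Fin n) →
           (∀ x → W 𝒯 E' u v r c' ≤ W 𝒯 E' u v r x) →
           w 𝒯 E' c c' ≡ 0
lemma4p6 𝒯 u v r c isLCA E' c' minimal =
  n≤0⇒n≡0 (+-cancelˡ-≤ (W 𝒯 E' u v r c) _ 0
    (≤-trans (LCA-bound ω ω-sym isLCA (path 𝒯 c c') (path-Unique c c'))
      (≤-trans (minimal c) (≤-reflexive (sym (+-identityʳ _))))))
  where
  open TreeProperties 𝒯
  ω : Fin _ → Fin _ → ℕ
  ω = edgeWeight 𝒯 E'
  ω-sym : ∀ x y → ω x y ≡ ω y x
  ω-sym x y = cong (λ b → if b then 0 else 1) (∨-comm (E' x y) (E' y x))
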